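{- Let $(a_n)_{n\ge0}$ be a sequence of rational numbers satisfying \[n^2a_n=(11n^2-11n+3)a_{n-1}+(n-1)^2a_{n-2}\quad\text{for all } n\ge2.\] Then $a_n\in\mathbb{Z}$ for all $n\ge0$ if and only if $(a_0,a_1)=(\alpha,3\alpha)$ for some $\alpha\in\mathbb{Z}$. -}

module Defs where

open import Data.Nat as ℕ using (ℕ)
open import Data.Integer as ℤ using (ℤ)
open import Data.Rational using (ℚ; _/_; _+_; _*_)
open import Data.Product using (∃)
open import Relation.Binary.PropositionalEquality using (_≡_)

ℤtoℚ : ℤ → ℚ
ℤtoℚ z = z / 1

ℕtoℚ : ℕ → ℚ
ℕtoℚ n = ℤ.+ n / 1

IsInteger : ℚ → Set
IsInteger q = ∃ λ (z : ℤ) → q ≡ ℤtoℚ z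

-- n² a_n = (11n² − 11n + 3) a_{n−1} + (n−1)² a_{n−2}  for all n ≥ 2,
-- written with n = m + 2 (all coefficients are natural numbers:
-- 11n² − 11n + 3 = 11 n (n−1) + 3).
Recurrence : (ℕ → ℚ) → Set
Recurrence a = ∀ (m : ℕ) →
  let n = m ℕ.+ 2 in
  ℕtoℚ (n ℕ.* n) * a n
    ≡ ℕtoℚ (11 ℕ.* n ℕ.* (m ℕ.+ 1) ℕ.+ 3) * a (m ℕ.+ 1)
      + ℕtoℚ ((m ℕ.+ 1) ℕ.* (m ℕ.+ 1)) * a m

module Submission where

-- The Apéry-like numbers u n = ∑ₖ C(n,k)² C(n+k,k) form an integral solution with (u 0, u 1) = (1, 3):
-- the recurrence operator applied to the summand telescopes in k, with an explicit rational
-- certificate found by Zeilberger's algorithm.  A rational solution is determined by its first two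
-- values, so (α, 3α) yields α · u, which is integral.  Conversely, for an integral solution z the
-- Casoratian W k = u k · z (k+1) − u (k+1) · z k satisfies (k+1)² |W k| = |W 0|, so every positive
-- integer divides W 0 = z 1 − 3 z 0, which forces z 1 = 3 z 0.

open import Data.Integer as ℤ using (ℤ; +_; _+_; _*_; _-_; -_; ∣_∣; NonZero)
import Data.Integer.Properties as ℤ
open import Data.Integer.Tactic.RingSolver using (solve; solve-∀)
open import Data.List using ([]; _∷_)
open import Data.Nat as ℕ using (ℕ; zero; suc; _≤_; _<_)
import Data.Nat.Properties as ℕ
open import Data.Nat.Combinatorics using (_C_; nC1≡n; k>n⇒nCk≡0; nCk+nC[k+1]≡[n+1]C[k+1])
import Data.Nat.Coprimality as Coprime
open import Data.Nat.Divisibility using (_∣_; ∣⇒≤; n∣m*n*o)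
open import Data.Product using (∃; _×_; _,_; proj₁; proj₂)
open import Data.Rational as ℚ using (ℚ; mkℚ; 1ℚ; 1/_)
import Data.Rational.Properties as ℚ
open import Function.Bundles using (_⇔_; mk⇔; Equivalence)
open import Relation.Binary.PropositionalEquality
open import Relation.Nullary using (contradiction)
open ≡-Reasoning

open import Defs

-- Binomial coefficients

pascal : ∀ n k → + (n C k) + + (n C suc k) ≡ + (suc n C suc k)
pascal n k = trans (ℤ.pos-+ (n C k) (n C suc k)) (cong +_ (nCk+nC[k+1]≡[n+1]C[k+1] n k))

[1+k]*[1+n]C[1+k]≡[1+n]*nCk : ∀ n k → + suc k * + (suc n C suc k) ≡ + suc n * + (n C k)
[1+k]*[1+n]C[1+k]≡[1+n]*nCk zero    zero    = refl
[1+k]*[1+n]C[1+k]≡[1+n]*nCk zero    (suc k) = ℤ.*-zeroʳ (+ suc (suc k))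
[1+k]*[1+n]C[1+k]≡[1+n]*nCk (suc n) zero    = begin
  + 1 * + (suc (suc n) C 1)  ≡⟨ ℤ.*-identityˡ _ ⟩
  + (suc (suc n) C 1)        ≡⟨ cong +_ (nC1≡n (suc (suc n))) ⟩
  + suc (suc n)              ≡⟨ ℤ.*-identityʳ _ ⟨
  + suc (suc n) * + 1        ∎
[1+k]*[1+n]C[1+k]≡[1+n]*nCk (suc n) (suc k) = begin
  + suc (suc k) * + (suc (suc n) C suc (suc k))
    ≡⟨ cong (+ suc (suc k) *_) (pascal (suc n) (suc k)) ⟨
  + suc (suc k) * (P + R)
    ≡⟨ regroup (+ k) P R ⟩
  P + (+ suc k * P + + suc (suc k) * R)
    ≡⟨ cong (_+_ P) (cong₂ _+_ ([1+k]*[1+n]C[1+k]≡[1+n]*nCk n k) ([1+k]*[1+n]C[1+k]≡[1+n]*nCk n (suc k))) ⟩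
  P + (+ suc n * + (n C k) + + suc n * + (n C suc k))
    ≡⟨ cong (_+_ P) (ℤ.*-distribˡ-+ (+ suc n) (+ (n C k)) (+ (n C suc k))) ⟨
  P + + suc n * (+ (n C k) + + (n C suc k))
    ≡⟨ cong (λ t → P + + suc n * t) (pascal n k) ⟩
  P + + suc n * P
    ≡⟨ collect (+ n) P ⟩
  + suc (suc n) * P ∎
  where
  P = + (suc n C suc k)
  R = + (suc n C suc (suc k))
  regroup : ∀ K P R → (+ 2 + K) * (P + R) ≡ P + ((+ 1 + K) * P + (+ 2 + K) * R)
  regroup = solve-∀
  collect : ∀ N P → P + (+ 1 + N) * P ≡ (+ 2 + N) * P
  collect = solve-∀
  spread : ∀ R₁ R₂ K p₁ S → (R₁ * K - R₂ * p₁) * S ≡ R₁ * (K * S) - R₂ * (p₁ * S)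
  spread = solve-∀
  factor : ∀ R₁ R₂ K S V → R₁ * (K * S) - R₂ * (K * V) ≡ K * (R₁ * S - R₂ * V)
  factor = solve-∀

[1+k]*nC[1+k]≡[n-k]*nCk : ∀ n k → + suc k * + (n C suc k) ≡ (+ n - + k) * + (n C k)
[1+k]*nC[1+k]≡[n-k]*nCk n k = begin
  + suc k * R                                 ≡⟨ split (+ k) P R ⟩
  + suc k * (P + R) - + suc k * P             ≡⟨ cong (λ t → + suc k * t - + suc k * P) (pascal n k) ⟩
  + suc k * + (suc n C suc k) - + suc k * P   ≡⟨ cong (_- + suc k * P) ([1+k]*[1+n]C[1+k]≡[1+n]*nCk n k) ⟩
  + suc n * P - + suc k * P                   ≡⟨ merge (+ n) (+ k) P ⟩
  (+ n - + k) * P                             ∎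
  where
  P = + (n C k)
  R = + (n C suc k)
  split : ∀ K P R → (+ 1 + K) * R ≡ (+ 1 + K) * (P + R) - (+ 1 + K) * P
  split = solve-∀
  merge : ∀ N K P → (+ 1 + N) * P - (+ 1 + K) * P ≡ (N - K) * P
  merge = solve-∀

[1+n-k]*[1+n]Ck≡[1+n]*nCk : ∀ n k → (+ suc n - + k) * + (suc n C k) ≡ + suc n * + (n C k)
[1+n-k]*[1+n]Ck≡[1+n]*nCk n zero    = cong (_* + 1) (ℤ.+-identityʳ (+ suc n))
[1+n-k]*[1+n]Ck≡[1+n]*nCk n (suc k) = begin
  (+ suc n - + suc k) * X                 ≡⟨ distrib (+ n) (+ k) X ⟩
  + suc n * X - + suc k * X               ≡⟨ cong₂ (λ s t → + suc n * s - t) (sym (pascal n k)) ([1+k]*[1+n]C[1+k]≡[1+n]*nCk n k) ⟩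
  + suc n * (P + R) - + suc n * P         ≡⟨ cancel (+ n) P R ⟩
  + suc n * R                             ∎
  where
  X = + (suc n C suc k)
  P = + (n C k)
  R = + (n C suc k)
  distrib : ∀ N K X → (+ 1 + N - (+ 1 + K)) * X ≡ (+ 1 + N) * X - (+ 1 + K) * X
  distrib = solve-∀
  cancel : ∀ N P R → (+ 1 + N) * (P + R) - (+ 1 + N) * P ≡ (+ 1 + N) * R
  cancel = solve-∀

[1+k]*[n+1+k]C[1+k]≡[1+n+k]*[n+k]Ck : ∀ n k →
  + suc k * + ((n ℕ.+ suc k) C suc k) ≡ + suc (n ℕ.+ k) * + ((n ℕ.+ k) C k)
[1+k]*[n+1+k]C[1+k]≡[1+n+k]*[n+k]Ck n k = begin
  + suc k * + ((n ℕ.+ suc k) C suc k)   ≡⟨ cong (λ i → + suc k * + (i C suc k)) (ℕ.+-suc n k) ⟩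
  + suc k * + (suc (n ℕ.+ k) C suc k)   ≡⟨ [1+k]*[1+n]C[1+k]≡[1+n]*nCk (n ℕ.+ k) k ⟩
  + suc (n ℕ.+ k) * + ((n ℕ.+ k) C k)   ∎

[1+k]*[n+1+k]C[1+k]≡[1+n]*[1+n+k]Ck : ∀ n k →
  + suc k * + ((n ℕ.+ suc k) C suc k) ≡ + suc n * + ((suc n ℕ.+ k) C k)
[1+k]*[n+1+k]C[1+k]≡[1+n]*[1+n+k]Ck n k = begin
  + suc k * + ((n ℕ.+ suc k) C suc k)          ≡⟨ cong (λ i → + suc k * + (i C suc k)) (ℕ.+-suc n k) ⟩
  + suc k * + (suc (n ℕ.+ k) C suc k)          ≡⟨ [1+k]*nC[1+k]≡[n-k]*nCk (suc (n ℕ.+ k)) k ⟩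
  (+ suc (n ℕ.+ k) - + k) * + ((suc n ℕ.+ k) C k) ≡⟨ cong (_* + ((suc n ℕ.+ k) C k)) (drop (+ n) (+ k)) ⟩
  + suc n * + ((suc n ℕ.+ k) C k)              ∎
  where
  drop : ∀ N K → + 1 + N + K - K ≡ + 1 + N
  drop = solve-∀

[1+n]*[1+n+k]Ck≡[1+n+k]*[n+k]Ck : ∀ n k →
  + suc n * + ((suc n ℕ.+ k) C k) ≡ + suc (n ℕ.+ k) * + ((n ℕ.+ k) C k)
[1+n]*[1+n+k]Ck≡[1+n+k]*[n+k]Ck n k =
  trans (sym ([1+k]*[n+1+k]C[1+k]≡[1+n]*[1+n+k]Ck n k)) ([1+k]*[n+1+k]C[1+k]≡[1+n+k]*[n+k]Ck n k)

-- Finite sums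

∑ : ℕ → (ℕ → ℤ) → ℤ
∑ zero    f = + 0
∑ (suc n) f = ∑ n f + f n

syntax ∑ n (λ k → e) = ∑[ k < n ] e

∑-cong : ∀ {f g} → (∀ k → f k ≡ g k) → ∀ n → ∑ n f ≡ ∑ n g
∑-cong f≗g zero    = refl
∑-cong f≗g (suc n) = cong₂ _+_ (∑-cong f≗g n) (f≗g n)

∑-distrib-- : ∀ n f g → ∑[ k < n ] (f k - g k) ≡ ∑ n f - ∑ n g
∑-distrib-- zero    f g = refl
∑-distrib-- (suc n) f g = trans (cong (_+ (f n - g n)) (∑-distrib-- n f g)) (interchange (∑ n f) (∑ n g) (f n) (g n))
  where
  interchange : ∀ F G x y → F - G + (x - y) ≡ F + x - (G + y)
  interchange = solve-∀

∑-*ˡ : ∀ c n f → ∑[ k < n ] (c * f k) ≡ c * ∑ n f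
∑-*ˡ c zero    f = sym (ℤ.*-zeroʳ c)
∑-*ˡ c (suc n) f = trans (cong (_+ c * f n) (∑-*ˡ c n f)) (sym (ℤ.*-distribˡ-+ c (∑ n f) (f n)))

∑-telescope : ∀ (g : ℕ → ℤ) n → ∑[ k < n ] (g k - g (suc k)) ≡ g 0 - g n
∑-telescope g zero    = sym (ℤ.+-inverseʳ (g 0))
∑-telescope g (suc n) = trans (cong (_+ (g n - g (suc n))) (∑-telescope g n)) (cancel (g 0) (g n) (g (suc n)))
  where
  cancel : ∀ a b c → a - b + (b - c) ≡ a - c
  cancel = solve-∀

∑-extend : ∀ {n} f → (∀ k → n ≤ k → f k ≡ + 0) → ∀ d → ∑ (d ℕ.+ n) f ≡ ∑ n f
∑-extend f vanish zero    = refl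
∑-extend {n} f vanish (suc d) = begin
  ∑ (d ℕ.+ n) f + f (d ℕ.+ n)  ≡⟨ cong₂ _+_ (∑-extend f vanish d) (vanish (d ℕ.+ n) (ℕ.m≤n+m n d)) ⟩
  ∑ n f + + 0                  ≡⟨ ℤ.+-identityʳ (∑ n f) ⟩
  ∑ n f                        ∎

-- Integers inside ℚ

ℤtoℚ≡mkℚ : ∀ z → ℤtoℚ z ≡ mkℚ z 0 (Coprime.sym (Coprime.1-coprimeTo ∣ z ∣))
ℤtoℚ≡mkℚ (+ n)      = ℚ.normalize-coprime (Coprime.sym (Coprime.1-coprimeTo n))
ℤtoℚ≡mkℚ ℤ.-[1+ n ] = cong ℚ.-_ (ℚ.normalize-coprime (Coprime.sym (Coprime.1-coprimeTo (suc n))))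

ℤtoℚ-injective : ∀ {x y} → ℤtoℚ x ≡ ℤtoℚ y → x ≡ y
ℤtoℚ-injective {x} {y} eq = cong ℚ.↥_ (trans (sym (ℤtoℚ≡mkℚ x)) (trans eq (ℤtoℚ≡mkℚ y)))

ℤtoℚ-homo-* : ∀ x y → ℤtoℚ (x * y) ≡ ℤtoℚ x ℚ.* ℤtoℚ y
ℤtoℚ-homo-* x y = sym (cong₂ ℚ._*_ (ℤtoℚ≡mkℚ x) (ℤtoℚ≡mkℚ y))

ℤtoℚ-homo-+ : ∀ x y → ℤtoℚ (x + y) ≡ ℤtoℚ x ℚ.+ ℤtoℚ y
ℤtoℚ-homo-+ x y = begin
  ℤtoℚ (x + y)              ≡⟨ cong₂ (λ s t → ℤtoℚ (s + t)) (ℤ.*-identityʳ x) (ℤ.*-identityʳ y) ⟨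
  ℤtoℚ (x * + 1 + y * + 1)  ≡⟨ cong₂ ℚ._+_ (ℤtoℚ≡mkℚ x) (ℤtoℚ≡mkℚ y) ⟨
  ℤtoℚ x ℚ.+ ℤtoℚ y         ∎

ℚ-*-cancelˡ-≡ : ∀ r p q .{{_ : ℚ.NonZero r}} → r ℚ.* p ≡ r ℚ.* q → p ≡ q
ℚ-*-cancelˡ-≡ r p q eq = begin
  p                     ≡⟨ ℚ.*-identityˡ p ⟨
  1ℚ ℚ.* p              ≡⟨ cong (ℚ._* p) (ℚ.*-inverseˡ r) ⟨
  (1/ r ℚ.* r) ℚ.* p    ≡⟨ ℚ.*-assoc (1/ r) r p ⟩
  1/ r ℚ.* (r ℚ.* p)    ≡⟨ cong (1/ r ℚ.*_) eq ⟩
  1/ r ℚ.* (r ℚ.* q)    ≡⟨ ℚ.*-assoc (1/ r) r q ⟨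
  (1/ r ℚ.* r) ℚ.* q    ≡⟨ cong (ℚ._* q) (ℚ.*-inverseˡ r) ⟩
  1ℚ ℚ.* q              ≡⟨ ℚ.*-identityˡ q ⟩
  q                     ∎

-- Three-term recurrences

module ThreeTermRecurrence (P Q R : ℕ → ℤ) where

  Solves : (ℕ → ℤ) → Set
  Solves z = ∀ m → P m * z (suc (suc m)) ≡ Q m * z (suc m) + R m * z m

  Solvesℚ : (ℕ → ℚ) → Set
  Solvesℚ a = ∀ m → ℤtoℚ (P m) ℚ.* a (suc (suc m)) ≡ ℤtoℚ (Q m) ℚ.* a (suc m) ℚ.+ ℤtoℚ (R m) ℚ.* a m

  Solves-*ˡ : ∀ {z} α → Solves z → Solves (λ n → α * z n)
  Solves-*ˡ {z} α z-solves m = begin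
    P m * (α * z (suc (suc m)))                          ≡⟨ swap (P m) α (z (suc (suc m))) ⟩
    α * (P m * z (suc (suc m)))                          ≡⟨ cong (α *_) (z-solves m) ⟩
    α * (Q m * z (suc m) + R m * z m)                    ≡⟨ distribute α (Q m) (R m) (z (suc m)) (z m) ⟩
    Q m * (α * z (suc m)) + R m * (α * z m)              ∎
    where
    swap : ∀ p α x → p * (α * x) ≡ α * (p * x)
    swap = solve-∀
    distribute : ∀ α q r x y → α * (q * x + r * y) ≡ q * (α * x) + r * (α * y)
    distribute = solve-∀

  Solves⇔Solvesℚ : ∀ z → Solves z ⇔ Solvesℚ (λ n → ℤtoℚ (z n))
  Solves⇔Solvesℚ z = mk⇔
    (λ z-solves m → trans (sym (ℤtoℚ-homo-lhs m)) (trans (cong ℤtoℚ (z-solves m)) (ℤtoℚ-homo-rhs m)))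
    (λ z-solves m → ℤtoℚ-injective (trans (ℤtoℚ-homo-lhs m) (trans (z-solves m) (sym (ℤtoℚ-homo-rhs m)))))
    where
    ℤtoℚ-homo-lhs : ∀ m → ℤtoℚ (P m * z (suc (suc m))) ≡ ℤtoℚ (P m) ℚ.* ℤtoℚ (z (suc (suc m)))
    ℤtoℚ-homo-lhs m = ℤtoℚ-homo-* (P m) (z (suc (suc m)))
    ℤtoℚ-homo-rhs : ∀ m → ℤtoℚ (Q m * z (suc m) + R m * z m)
                           ≡ ℤtoℚ (Q m) ℚ.* ℤtoℚ (z (suc m)) ℚ.+ ℤtoℚ (R m) ℚ.* ℤtoℚ (z m)
    ℤtoℚ-homo-rhs m = trans (ℤtoℚ-homo-+ (Q m * z (suc m)) (R m * z m))
      (cong₂ ℚ._+_ (ℤtoℚ-homo-* (Q m) (z (suc m))) (ℤtoℚ-homo-* (R m) (z m)))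

  Solvesℚ-resp-≗ : ∀ {a b} → (∀ n → a n ≡ b n) → Solvesℚ a → Solvesℚ b
  Solvesℚ-resp-≗ {a} {b} a≗b a-solves m = begin
    ℤtoℚ (P m) ℚ.* b (suc (suc m))                         ≡⟨ cong (ℤtoℚ (P m) ℚ.*_) (a≗b (suc (suc m))) ⟨
    ℤtoℚ (P m) ℚ.* a (suc (suc m))                         ≡⟨ a-solves m ⟩
    ℤtoℚ (Q m) ℚ.* a (suc m) ℚ.+ ℤtoℚ (R m) ℚ.* a m        ≡⟨ cong₂ (λ s t → ℤtoℚ (Q m) ℚ.* s ℚ.+ ℤtoℚ (R m) ℚ.* t) (a≗b (suc m)) (a≗b m) ⟩
    ℤtoℚ (Q m) ℚ.* b (suc m) ℚ.+ ℤtoℚ (R m) ℚ.* b m        ∎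

  Solvesℚ-unique : ∀ {a b} → (∀ m → P m ≢ + 0) → Solvesℚ a → Solvesℚ b →
                   a 0 ≡ b 0 → a 1 ≡ b 1 → ∀ n → a n ≡ b n
  Solvesℚ-unique {a} {b} P≢0 a-solves b-solves a₀≡b₀ a₁≡b₁ n = proj₁ (agree n)
    where
    agree : ∀ n → a n ≡ b n × a (suc n) ≡ b (suc n)
    agree zero    = a₀≡b₀ , a₁≡b₁
    agree (suc m) with agree m
    ... | aₘ≡bₘ , aₘ₊₁≡bₘ₊₁ = aₘ₊₁≡bₘ₊₁ , ℚ-*-cancelˡ-≡ (ℤtoℚ (P m)) _ _ {{Pₘ≢0}} (begin
      ℤtoℚ (P m) ℚ.* a (suc (suc m))                    ≡⟨ a-solves m ⟩
      ℤtoℚ (Q m) ℚ.* a (suc m) ℚ.+ ℤtoℚ (R m) ℚ.* a m   ≡⟨ cong₂ (λ s t → ℤtoℚ (Q m) ℚ.* s ℚ.+ ℤtoℚ (R m) ℚ.* t) aₘ₊₁≡bₘ₊₁ aₘ≡bₘ ⟩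
      ℤtoℚ (Q m) ℚ.* b (suc m) ℚ.+ ℤtoℚ (R m) ℚ.* b m   ≡⟨ b-solves m ⟨
      ℤtoℚ (P m) ℚ.* b (suc (suc m))                    ∎)
      where Pₘ≢0 = ℚ.≢-nonZero (λ eq → P≢0 m (ℤtoℚ-injective eq))

  casoratian : (ℕ → ℤ) → (ℕ → ℤ) → ℕ → ℤ
  casoratian u z k = u k * z (suc k) - u (suc k) * z k

  casoratian-step : ∀ u z → Solves u → Solves z →
                    ∀ m → P m * casoratian u z (suc m) ≡ - (R m * casoratian u z m)
  casoratian-step u z u-solves z-solves m = begin
    P m * (u₁ * z₂ - u₂ * z₁)                                ≡⟨ expand (P m) u₁ u₂ z₁ z₂ ⟩
    u₁ * (P m * z₂) - z₁ * (P m * u₂)                        ≡⟨ cong₂ (λ s t → u₁ * s - z₁ * t) (z-solves m) (u-solves m) ⟩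
    u₁ * (Q m * z₁ + R m * z₀) - z₁ * (Q m * u₁ + R m * u₀)  ≡⟨ cancel (Q m) (R m) u₀ u₁ z₀ z₁ ⟩
    - (R m * (u₀ * z₁ - u₁ * z₀))                            ∎
    where
    u₀ = u m
    u₁ = u (suc m)
    u₂ = u (suc (suc m))
    z₀ = z m
    z₁ = z (suc m)
    z₂ = z (suc (suc m))
    expand : ∀ P u₁ u₂ z₁ z₂ → P * (u₁ * z₂ - u₂ * z₁) ≡ u₁ * (P * z₂) - z₁ * (P * u₂)
    expand = solve-∀
    cancel : ∀ Q R u₀ u₁ z₀ z₁ → u₁ * (Q * z₁ + R * z₀) - z₁ * (Q * u₁ + R * u₀) ≡ - (R * (u₀ * z₁ - u₁ * z₀))
    cancel = solve-∀

-- The Apéry-like numbers solve the recurrence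

lead mid trail : ℕ → ℤ
lead  m = + (suc (suc m) ℕ.* suc (suc m))
mid   m = + (11 ℕ.* suc (suc m) ℕ.* suc m ℕ.+ 3)
trail m = + (suc m ℕ.* suc m)

open ThreeTermRecurrence lead mid trail

apéryTerm : ℕ → ℕ → ℤ
apéryTerm n k = + (n C k) * + (n C k) * + ((n ℕ.+ k) C k)

apéry : ℕ → ℤ
apéry n = ∑[ k < suc n ] apéryTerm n k

apéryTerm-vanishes : ∀ n k → n < k → apéryTerm n k ≡ + 0
apéryTerm-vanishes n k n<k rewrite k>n⇒nCk≡0 n<k = refl

d³[a²b]≡p²q[x²y] : ∀ d p q {a b x y} → d * a ≡ p * x → d * b ≡ q * y →
                   d * d * d * (a * a * b) ≡ p * p * q * (x * x * y)
d³[a²b]≡p²q[x²y] d p q {a} {b} {x} {y} da≡px db≡qy = begin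
  d * d * d * (a * a * b)      ≡⟨ solve (d ∷ a ∷ b ∷ []) ⟩
  (d * a) * (d * a) * (d * b)  ≡⟨ cong₂ (λ u v → u * u * v) da≡px db≡qy ⟩
  (p * x) * (p * x) * (q * y)  ≡⟨ solve (p ∷ q ∷ x ∷ y ∷ []) ⟩
  p * p * q * (x * x * y)      ∎

certificate : ℤ → ℤ → ℤ
certificate M K = + 11 * N * N - + 7 * N - (+ 6 * N - + 5) * K - K * K
  where N = + 2 + M

certificate-identity : ∀ M J →
    (+ 2 + M) * (+ 2 + M) * ((+ 1 + M) * ((+ 2 + M) * (+ 2 + M) * (+ 3 + M + J)) * (+ 2 + M + J))
  - (+ 11 * (+ 2 + M) * (+ 1 + M) + + 3) * ((+ 1 + M) * (+ 2 + M) * ((+ 1 + M - J) * (+ 1 + M - J) * (+ 2 + M + J)))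
  - (+ 1 + M) * (+ 1 + M) * ((+ 2 + M) * (M - J) * (M - J) * ((+ 1 + M - J) * (+ 1 + M - J)))
  ≡ (+ 11 * (+ 2 + M) * (+ 2 + M) - + 7 * (+ 2 + M) - (+ 6 * (+ 2 + M) - + 5) * (+ 1 + J) - (+ 1 + J) * (+ 1 + J))
      * ((+ 1 + M) * (+ 2 + M) * ((+ 1 + J) * (+ 1 + J) * (+ 1 + J)))
  - (+ 11 * (+ 2 + M) * (+ 2 + M) - + 7 * (+ 2 + M) - (+ 6 * (+ 2 + M) - + 5) * (+ 2 + J) - (+ 2 + J) * (+ 2 + J))
      * ((+ 1 + M) * (+ 2 + M) * ((+ 1 + M - J) * (+ 1 + M - J) * (+ 2 + M + J)))
certificate-identity = solve-∀

-- At (m, j) = (M, J): x²y, A²B, a²b and a₀²b₀ stand for apéryTerm at (m+1, j), (m+1, j+1),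
-- (m+2, j+1) and (m, j+1), with x = C(m+1,j), y = C(m+1+j,j), c = C(m+2+j,j) and x₀ = C(m,j);
-- the hypotheses are the ratios between these binomial coefficients.
telescoping-step : ∀ M J x y a b c A B a₀ b₀ x₀ →
  .{{_ : NonZero ((+ 1 + M) * (+ 2 + M) * ((+ 1 + J) * (+ 1 + J) * (+ 1 + J)))}} →
  (+ 1 + J) * a  ≡ (+ 2 + M) * x →
  (+ 1 + J) * b  ≡ (+ 3 + M + J) * c →
  (+ 2 + M) * c  ≡ (+ 2 + M + J) * y →
  (+ 1 + J) * A  ≡ (+ 1 + M - J) * x →
  (+ 1 + J) * B  ≡ (+ 2 + M + J) * y →
  (+ 1 + J) * a₀ ≡ (M - J) * x₀ →
  (+ 1 + J) * b₀ ≡ (+ 1 + M) * y →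
  (+ 1 + M - J) * x ≡ (+ 1 + M) * x₀ →
    (+ 2 + M) * (+ 2 + M) * (a * a * b) - (+ 11 * (+ 2 + M) * (+ 1 + M) + + 3) * (A * A * B)
    - (+ 1 + M) * (+ 1 + M) * (a₀ * a₀ * b₀)
  ≡ certificate M (+ 1 + J) * (x * x * y) - certificate M (+ 2 + J) * (A * A * B)
-- Multiplying by K clears all denominators of the ratios, leaving certificate-identity.
telescoping-step M J x y a b c A B a₀ b₀ x₀ h₁ h₂ h₃ h₄ h₅ h₆ h₇ h₈ = ℤ.*-cancelˡ-≡ K _ _ (begin
    K * (L₂ * U - L₁ * V - L₀ * W)                ≡⟨ distribute K L₂ L₁ L₀ U V W ⟩
    L₂ * (K * U) - L₁ * (K * V) - L₀ * (K * W)    ≡⟨ cong₂ (λ u v → L₂ * u - L₁ * v - L₀ * (K * W)) KU KV ⟩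
    L₂ * (p₂ * S) - L₁ * (p₁ * S) - L₀ * (K * W)  ≡⟨ cong (λ w → L₂ * (p₂ * S) - L₁ * (p₁ * S) - L₀ * w) KW ⟩
    L₂ * (p₂ * S) - L₁ * (p₁ * S) - L₀ * (p₀ * S) ≡⟨ collect L₂ L₁ L₀ p₂ p₁ p₀ S ⟩
    (L₂ * p₂ - L₁ * p₁ - L₀ * p₀) * S             ≡⟨ cong (_* S) (certificate-identity M J) ⟩
    (R₁ * K - R₂ * p₁) * S                        ≡⟨ spread R₁ R₂ K p₁ S ⟩
    R₁ * (K * S) - R₂ * (p₁ * S)                  ≡⟨ cong (λ v → R₁ * (K * S) - R₂ * v) KV ⟨
    R₁ * (K * S) - R₂ * (K * V)                   ≡⟨ factor R₁ R₂ K S V ⟩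
    K * (R₁ * S - R₂ * V)                         ∎)
  where
  d  = + 1 + J
  E  = (+ 1 + M) * (+ 2 + M)
  K  = E * (d * d * d)
  L₂ = (+ 2 + M) * (+ 2 + M)
  L₁ = + 11 * (+ 2 + M) * (+ 1 + M) + + 3
  L₀ = (+ 1 + M) * (+ 1 + M)
  R₁ = certificate M (+ 1 + J)
  R₂ = certificate M (+ 2 + J)
  S  = x * x * y
  U  = a * a * b
  V  = A * A * B
  W  = a₀ * a₀ * b₀
  q₂ = (+ 2 + M) * (+ 2 + M) * (+ 3 + M + J)
  q₁ = (+ 1 + M - J) * (+ 1 + M - J) * (+ 2 + M + J)
  p₂ = (+ 1 + M) * q₂ * (+ 2 + M + J)
  p₁ = E * q₁
  p₀ = (+ 2 + M) * (M - J) * (M - J) * ((+ 1 + M - J) * (+ 1 + M - J))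
  distribute : ∀ K L₂ L₁ L₀ U V W → K * (L₂ * U - L₁ * V - L₀ * W) ≡ L₂ * (K * U) - L₁ * (K * V) - L₀ * (K * W)
  distribute = solve-∀
  collect : ∀ L₂ L₁ L₀ p₂ p₁ p₀ S → L₂ * (p₂ * S) - L₁ * (p₁ * S) - L₀ * (p₀ * S) ≡ (L₂ * p₂ - L₁ * p₁ - L₀ * p₀) * S
  collect = solve-∀
  spread : ∀ R₁ R₂ K p₁ S → (R₁ * K - R₂ * p₁) * S ≡ R₁ * (K * S) - R₂ * (p₁ * S)
  spread = solve-∀
  factor : ∀ R₁ R₂ K S V → R₁ * (K * S) - R₂ * (K * V) ≡ K * (R₁ * S - R₂ * V)
  factor = solve-∀
  KU : K * U ≡ p₂ * S
  KU = begin
    K * U                                           ≡⟨ ℤ.*-assoc E (d * d * d) U ⟩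
    E * (d * d * d * U)                             ≡⟨ cong (E *_) (d³[a²b]≡p²q[x²y] d (+ 2 + M) (+ 3 + M + J) h₁ h₂) ⟩
    E * (q₂ * (x * x * c))                          ≡⟨ shift (+ 1 + M) (+ 2 + M) q₂ x c ⟩
    (+ 1 + M) * q₂ * (x * x * ((+ 2 + M) * c))      ≡⟨ cong (λ t → (+ 1 + M) * q₂ * (x * x * t)) h₃ ⟩
    (+ 1 + M) * q₂ * (x * x * ((+ 2 + M + J) * y))  ≡⟨ pull ((+ 1 + M) * q₂) (+ 2 + M + J) x y ⟩
    p₂ * S                                          ∎
    where
    shift : ∀ e f q x c → e * f * (q * (x * x * c)) ≡ e * q * (x * x * (f * c))
    shift = solve-∀
    pull : ∀ r g x y → r * (x * x * (g * y)) ≡ r * g * (x * x * y)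
    pull = solve-∀
  KV : K * V ≡ p₁ * S
  KV = begin
    K * V                   ≡⟨ ℤ.*-assoc E (d * d * d) V ⟩
    E * (d * d * d * V)     ≡⟨ cong (E *_) (d³[a²b]≡p²q[x²y] d (+ 1 + M - J) (+ 2 + M + J) h₄ h₅) ⟩
    E * (q₁ * S)            ≡⟨ ℤ.*-assoc E q₁ S ⟨
    p₁ * S                  ∎
  KW : K * W ≡ p₀ * S
  KW = begin
    K * W                                                   ≡⟨ ℤ.*-assoc E (d * d * d) W ⟩
    E * (d * d * d * W)                                     ≡⟨ cong (E *_) (d³[a²b]≡p²q[x²y] d (M - J) (+ 1 + M) h₆ h₇) ⟩
    E * ((M - J) * (M - J) * (+ 1 + M) * (x₀ * x₀ * y))     ≡⟨ shift (+ 1 + M) (+ 2 + M) (M - J) x₀ y ⟩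
    r * ((+ 1 + M) * x₀ * ((+ 1 + M) * x₀) * y)             ≡⟨ cong (λ t → r * (t * t * y)) h₈ ⟨
    r * ((+ 1 + M - J) * x * ((+ 1 + M - J) * x) * y)       ≡⟨ pull r (+ 1 + M - J) x y ⟩
    p₀ * S                                                  ∎
    where
    r = (+ 2 + M) * (M - J) * (M - J)
    shift : ∀ e f t x₀ y → e * f * (t * t * e * (x₀ * x₀ * y)) ≡ f * t * t * (e * x₀ * (e * x₀) * y)
    shift = solve-∀
    pull : ∀ r h x y → r * (h * x * (h * x) * y) ≡ r * (h * h) * (x * x * y)
    pull = solve-∀

residual : ℕ → ℕ → ℤ
residual m k = lead m * apéryTerm (suc (suc m)) k - mid m * apéryTerm (suc m) k - trail m * apéryTerm m k

companion : ℕ → ℕ → ℤ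
companion m zero    = + 0
companion m (suc j) = certificate (+ m) (+ suc j) * apéryTerm (suc m) j

residual≡Δcompanion : ∀ m k → residual m k ≡ companion m k - companion m (suc k)
residual≡Δcompanion m zero    = base (+ m)
  where
  base : ∀ M → (+ 2 + M) * (+ 2 + M) * + 1 - (+ 11 * (+ 2 + M) * (+ 1 + M) + + 3) * + 1 - (+ 1 + M) * (+ 1 + M) * + 1
             ≡ + 0 - (+ 11 * (+ 2 + M) * (+ 2 + M) - + 7 * (+ 2 + M) - (+ 6 * (+ 2 + M) - + 5) * + 1 - + 1 * + 1) * + 1
  base = solve-∀
residual≡Δcompanion m (suc j) = telescoping-step (+ m) (+ j) x y a b c A B a₀ b₀ x₀
  ([1+k]*[1+n]C[1+k]≡[1+n]*nCk (suc m) j)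
  ([1+k]*[n+1+k]C[1+k]≡[1+n+k]*[n+k]Ck (suc (suc m)) j)
  ([1+n]*[1+n+k]Ck≡[1+n+k]*[n+k]Ck (suc m) j)
  ([1+k]*nC[1+k]≡[n-k]*nCk (suc m) j)
  ([1+k]*[n+1+k]C[1+k]≡[1+n+k]*[n+k]Ck (suc m) j)
  ([1+k]*nC[1+k]≡[n-k]*nCk m j)
  ([1+k]*[n+1+k]C[1+k]≡[1+n]*[1+n+k]Ck m j)
  ([1+n-k]*[1+n]Ck≡[1+n]*nCk m j)
  where
  x  = + (suc m C j)
  y  = + ((suc m ℕ.+ j) C j)
  a  = + (suc (suc m) C suc j)
  b  = + ((suc (suc m) ℕ.+ suc j) C suc j)
  c  = + ((suc (suc m) ℕ.+ j) C j)
  A  = + (suc m C suc j)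
  B  = + ((suc m ℕ.+ suc j) C suc j)
  a₀ = + (m C suc j)
  b₀ = + ((m ℕ.+ suc j) C suc j)
  x₀ = + (m C j)

∑-residual : ∀ m n → ∑ n (residual m) ≡
  lead m * ∑ n (apéryTerm (suc (suc m))) - mid m * ∑ n (apéryTerm (suc m)) - trail m * ∑ n (apéryTerm m)
∑-residual m n = begin
  ∑ n (residual m)
    ≡⟨ ∑-distrib-- n (λ k → lead m * F₂ k - mid m * F₁ k) (λ k → trail m * F₀ k) ⟩
  ∑[ k < n ] (lead m * F₂ k - mid m * F₁ k) - ∑[ k < n ] (trail m * F₀ k)
    ≡⟨ cong (_- ∑[ k < n ] (trail m * F₀ k)) (∑-distrib-- n (λ k → lead m * F₂ k) (λ k → mid m * F₁ k)) ⟩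
  ∑[ k < n ] (lead m * F₂ k) - ∑[ k < n ] (mid m * F₁ k) - ∑[ k < n ] (trail m * F₀ k)
    ≡⟨ cong₂ _-_ (cong₂ _-_ (∑-*ˡ (lead m) n F₂) (∑-*ˡ (mid m) n F₁)) (∑-*ˡ (trail m) n F₀) ⟩
  lead m * ∑ n F₂ - mid m * ∑ n F₁ - trail m * ∑ n F₀
    ∎
  where
  F₂ = apéryTerm (suc (suc m))
  F₁ = apéryTerm (suc m)
  F₀ = apéryTerm m

apéry-solves : Solves apéry
apéry-solves m = ℤ.i-j≡0⇒i≡j _ _ (begin
  lead m * apéry (suc (suc m)) - (mid m * apéry (suc m) + trail m * apéry m)
    ≡⟨ sub-sum (lead m * apéry (suc (suc m))) (mid m * apéry (suc m)) (trail m * apéry m) ⟩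
  lead m * apéry (suc (suc m)) - mid m * apéry (suc m) - trail m * apéry m
    ≡⟨ cong₂ (λ s t → lead m * apéry (suc (suc m)) - mid m * s - trail m * t)
             (∑-extend F₁ (apéryTerm-vanishes (suc m)) 1) (∑-extend F₀ (apéryTerm-vanishes m) 2) ⟨
  lead m * ∑ N F₂ - mid m * ∑ N F₁ - trail m * ∑ N F₀
    ≡⟨ ∑-residual m N ⟨
  ∑ N (residual m)
    ≡⟨ ∑-cong (residual≡Δcompanion m) N ⟩
  ∑[ k < N ] (companion m k - companion m (suc k))
    ≡⟨ ∑-telescope (companion m) N ⟩
  + 0 - certificate (+ m) (+ N) * F₁ (suc (suc m))
    ≡⟨ cong (λ t → + 0 - certificate (+ m) (+ N) * t) (apéryTerm-vanishes (suc m) (suc (suc m)) (ℕ.n<1+n (suc m))) ⟩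
  + 0 - certificate (+ m) (+ N) * + 0
    ≡⟨ cong (_-_ (+ 0)) (ℤ.*-zeroʳ (certificate (+ m) (+ N))) ⟩
  + 0 ∎)
  where
  N  = suc (suc (suc m))
  F₂ = apéryTerm (suc (suc m))
  F₁ = apéryTerm (suc m)
  F₀ = apéryTerm m
  sub-sum : ∀ P Q R → P - (Q + R) ≡ P - Q - R
  sub-sum = solve-∀

-- Integral solutions

[1+k]²∣casoratian∣≡∣casoratian₀∣ : ∀ u z → Solves u → Solves z →
  ∀ k → suc k ℕ.* suc k ℕ.* ∣ casoratian u z k ∣ ≡ ∣ casoratian u z 0 ∣
[1+k]²∣casoratian∣≡∣casoratian₀∣ u z u-solves z-solves zero = ℕ.*-identityˡ ∣ casoratian u z 0 ∣
[1+k]²∣casoratian∣≡∣casoratian₀∣ u z u-solves z-solves (suc m) = begin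
  suc (suc m) ℕ.* suc (suc m) ℕ.* ∣ W (suc m) ∣  ≡⟨ ℤ.abs-* (lead m) (W (suc m)) ⟨
  ∣ lead m * W (suc m) ∣                          ≡⟨ cong ∣_∣ (casoratian-step u z u-solves z-solves m) ⟩
  ∣ - (trail m * W m) ∣                           ≡⟨ ℤ.∣-i∣≡∣i∣ (trail m * W m) ⟩
  ∣ trail m * W m ∣                               ≡⟨ ℤ.abs-* (trail m) (W m) ⟩
  suc m ℕ.* suc m ℕ.* ∣ W m ∣                     ≡⟨ [1+k]²∣casoratian∣≡∣casoratian₀∣ u z u-solves z-solves m ⟩
  ∣ W 0 ∣                                         ∎
  where W = casoratian u z

∀[1+k∣n]⇒n≡0 : ∀ {n} → (∀ k → suc k ∣ n) → n ≡ 0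
∀[1+k∣n]⇒n≡0 {zero}  _       = refl
∀[1+k∣n]⇒n≡0 {suc n} 1+k∣1+n = contradiction (∣⇒≤ (1+k∣1+n (suc n))) ℕ.1+n≰n

casoratian₀≡0 : ∀ u z → Solves u → Solves z → casoratian u z 0 ≡ + 0
casoratian₀≡0 u z u-solves z-solves = ℤ.∣i∣≡0⇒i≡0 (∀[1+k∣n]⇒n≡0 λ k →
  subst (suc k ∣_) ([1+k]²∣casoratian∣≡∣casoratian₀∣ u z u-solves z-solves k) (n∣m*n*o (suc k) ∣ casoratian u z k ∣))

solution⇒z₁≡3z₀ : ∀ z → Solves z → z 1 ≡ + 3 * z 0
solution⇒z₁≡3z₀ z z-solves = ℤ.i-j≡0⇒i≡j (z 1) (+ 3 * z 0)
  (trans (cong (_- + 3 * z 0) (sym (ℤ.*-identityˡ (z 1)))) (casoratian₀≡0 apéry z apéry-solves z-solves))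

Recurrence⇒Solvesℚ : ∀ {a} → Recurrence a → Solvesℚ a
Recurrence⇒Solvesℚ {a} rec m = subst₂ shape (ℕ.+-comm m 2) (ℕ.+-comm m 1) (rec m)
  where
  shape : ℕ → ℕ → Set
  shape n n′ = ℕtoℚ (n ℕ.* n) ℚ.* a n ≡ ℕtoℚ (11 ℕ.* n ℕ.* n′ ℕ.+ 3) ℚ.* a n′ ℚ.+ ℕtoℚ (n′ ℕ.* n′) ℚ.* a m

lead≢0 : ∀ m → lead m ≢ + 0
lead≢0 m ()

theorem6p1 : (a : ℕ → ℚ) → Recurrence a →
    ((∀ (n : ℕ) → IsInteger (a n)) ⇔ (∃ λ (α : ℤ) → (a 0 ≡ ℤtoℚ α) × (a 1 ≡ ℤtoℚ ((+ 3) * α))))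
theorem6p1 a rec = mk⇔ integral⇒initial initial⇒integral
  where
  integral⇒initial : (∀ n → IsInteger (a n)) → ∃ λ α → (a 0 ≡ ℤtoℚ α) × (a 1 ≡ ℤtoℚ (+ 3 * α))
  integral⇒initial integral = z 0 , a≡z 0 , trans (a≡z 1) (cong ℤtoℚ (solution⇒z₁≡3z₀ z z-solves))
    where
    z : ℕ → ℤ
    z n = proj₁ (integral n)
    a≡z : ∀ n → a n ≡ ℤtoℚ (z n)
    a≡z n = proj₂ (integral n)
    z-solves : Solves z
    z-solves = Equivalence.from (Solves⇔Solvesℚ z) (Solvesℚ-resp-≗ a≡z (Recurrence⇒Solvesℚ rec))
  initial⇒integral : (∃ λ α → (a 0 ≡ ℤtoℚ α) × (a 1 ≡ ℤtoℚ (+ 3 * α))) → ∀ n → IsInteger (a n)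
  initial⇒integral (α , a₀≡α , a₁≡3α) n = α * apéry n ,
    Solvesℚ-unique lead≢0 (Recurrence⇒Solvesℚ rec) (Equivalence.to (Solves⇔Solvesℚ z) (Solves-*ˡ α apéry-solves))
      (trans a₀≡α (cong ℤtoℚ (sym (ℤ.*-identityʳ α)))) (trans a₁≡3α (cong ℤtoℚ (ℤ.*-comm (+ 3) α))) n
    where
    z : ℕ → ℤ
    z n = α * apéry n
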